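{- The mapping $\delta\circ\gamma$ is the identity mapping on tree-oriented maps; that is, if $\vec M$ is a tree-oriented map and $T$ is the spanning tree returned by $\gamma$ on $\vec M$, then $\delta(M_T)=\vec M$.
   Context: A (rooted planar) map is a 2-cell embedding of a connected planar graph (loops and multiple edges allowed) in the oriented sphere up to orientation-preserving homeomorphism, with a distinguished half-edge, the root; its incident vertex is the root-vertex. In an oriented map each edge goes from origin (tail) to end (head); the root is considered a head. A positive cycle is a directed simple cycle having the root in its exterior region (the region on its right). An oriented map is tree-oriented if it has no positive cycle and every vertex can be reached from the root-vertex by a directed path. For a map $M$ with spanning tree $T$, the tour of $T$ follows its border counterclockwise from the root back to the root, inducing a linear order ("precedes around $T$") on half-edges not in $T$; $\delta(M_T)$ is the orientation of $M$ in which edges of $T$ point away from the root-vertex and each edge not in $T$ has its head preceding its tail around $T$. Procedure $\gamma$: start with $T$ consisting of the root and the root-vertex; make the tour of $T$ starting from the root, and whenever the tail of an edge $e$ is encountered while its head has not been encountered yet, add $e$ (with its end) to $T$; continue the tour (following $e$'s border if $e\in T$, crossing $e$ otherwise); stop at the root and return $T$ (this yields a spanning tree of the underlying map $M$). -}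

module Defs where

open import Data.Nat using (ℕ; zero; suc; _+_; _*_; _≤_; _<_; _≤ᵇ_)
open import Data.Fin using (Fin; toℕ; _≟_)
open import Data.Bool using (Bool; true; false; not; _∧_; if_then_else_)
open import Data.List using (List; length; filterᵇ; upTo; allFin; map)
open import Data.Bool.ListAction using (and)
open import Data.Product using (Σ; ∃; _×_; _,_)
open import Data.Sum using (_⊎_)
open import Relation.Nullary using (¬_; does)
open import Relation.Binary.PropositionalEquality using (_≡_; _≢_)
import Data.List as L
import Data.Fin as F

iter : {A : Set} → (A → A) → ℕ → A → A
iter f zero    x = x
iter f (suc j) x = f (iter f j x)

update : {m : ℕ} {B : Set} → (Fin m → B) → Fin m → B → Fin m → B
update f x b y = if does (y ≟ x) then b else f y

-- number of orbits (cycles) of a map p : Fin m → Fin m (meant for a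
-- permutation): the number of h which are the least element (w.r.t. the
-- order of Fin m) of their orbit {p^j h | j < m}.
isOrbitMin : {m : ℕ} → (Fin m → Fin m) → Fin m → Bool
isOrbitMin {m} p h = and (map (λ j → toℕ h ≤ᵇ toℕ (iter p j h)) (upTo m))

numOrbits : {m : ℕ} → (Fin m → Fin m) → ℕ
numOrbits {m} p = length (filterᵇ (isOrbitMin p) (allFin m))

-- Half-edges are Fin m; α is the fixed-point-free involution pairing the
-- two halves of each edge; σ is the counterclockwise rotation of
-- half-edges around their vertex (vertices = cycles of σ); faces are the
-- cycles of σ ∘ α.  The map is connected (every half-edge reachable from
-- the root via α and σ) and planar (Euler: V + F = E + 2, E = m/2).
-- The root is a half-edge r; the root is drawn as a dangling half-edge
-- (considered a head) placed in the corner of the root-vertex that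
-- immediately precedes r in counterclockwise order, so that the tour of a
-- tree starting from the root first encounters r.

data Conn {m : ℕ} (α σ : Fin m → Fin m) (r : Fin m) : Fin m → Set where
  here  : Conn α σ r r
  viaσ  : ∀ {h} → Conn α σ r h → Conn α σ r (σ h)
  viaα  : ∀ {h} → Conn α σ r h → Conn α σ r (α h)

record Map (m : ℕ) : Set where
  field
    α        : Fin m → Fin m
    σ        : Fin m → Fin m
    σ⁻       : Fin m → Fin m
    α-invol  : ∀ h → α (α h) ≡ h
    α-fpf    : ∀ h → α h ≢ h
    σσ⁻      : ∀ h → σ (σ⁻ h) ≡ h
    σ⁻σ      : ∀ h → σ⁻ (σ h) ≡ h
    root     : Fin m
    connected : ∀ h → Conn α σ root h
    planar   : 2 * (numOrbits σ + numOrbits (λ h → σ (α h))) ≡ m + 4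

module _ {m : ℕ} (M : Map m) where
  open Map M

  SameVertex : Fin m → Fin m → Set
  SameVertex h h' = ∃ λ j → iter σ j h ≡ h'

  -- Orientations: head h = true iff half-edge h is the head (end) of its
  -- edge.  Exactly one half of each edge is the head.
  record Orientation : Set where
    field
      head   : Fin m → Bool
      head-α : ∀ h → head (α h) ≡ not (head h)

  IsTail : Orientation → Fin m → Set
  IsTail o h = Orientation.head o h ≡ false

  -- directed reachability from the root-vertex: DReach o h means the
  -- vertex incident to h can be reached from the root-vertex by a
  -- directed path (moving around a vertex is free; an edge can be
  -- traversed from its tail to its head).
  data DReach (o : Orientation) : Fin m → Set where
    start : DReach o root
    turn  : ∀ {h} → DReach o h → DReach o (σ h)
    go    : ∀ {h} → DReach o h → IsTail o h → DReach o (α h)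

  -- A corner is denoted by the half-edge immediately following it in
  -- counterclockwise order.  Two corners are in the same region if they
  -- are linked by moves staying in a face (corner before h ~ corner
  -- before σ(α h), along edge h) or crossing an edge not in C (corner
  -- before h ~ corner before σ h).
  data CornerStep (C : Fin m → Set) : Fin m → Fin m → Set where
    alongEdge : ∀ h → CornerStep C h (σ (α h))
    crossEdge : ∀ h → ¬ C h → CornerStep C h (σ h)

  data SameRegion (C : Fin m → Set) (c : Fin m) : Fin m → Set where
    refl-r : SameRegion C c c
    fwd    : ∀ {a b} → SameRegion C c a → CornerStep C a b → SameRegion C c b
    bwd    : ∀ {a b} → SameRegion C c a → CornerStep C b a → SameRegion C c b

  -- A positive cycle: a directed simple cycle given by its tails
  -- t 0, …, t k (edge i goes from the vertex of t i to the vertex of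
  -- α (t i), which is the vertex of t (i+1), cyclically), whose vertices
  -- are pairwise distinct, and such that the root (the root corner) lies
  -- in the region on its right.  The corner just after the head α (t 0)
  -- in counterclockwise order, i.e. the corner before σ (α (t 0)), lies
  -- on the right of the cycle.
  record PositiveCycle (o : Orientation) : Set where
    field
      k      : ℕ
      t      : ℕ → Fin m
      tails  : ∀ i → i ≤ k → IsTail o (t i)
      chain  : ∀ i → i < k → SameVertex (α (t i)) (t (suc i))
      close  : SameVertex (α (t k)) (t 0)
      simple : ∀ i j → i < j → j ≤ k → ¬ SameVertex (t i) (t j)
    OnCycle : Fin m → Set
    OnCycle h = ∃ λ i → i ≤ k × (h ≡ t i ⊎ h ≡ α (t i))
    field
      rootOnRight : SameRegion OnCycle root (σ (α (t 0)))

  TreeOriented : Orientation → Set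
  TreeOriented o = (¬ PositiveCycle o) × (∀ h → DReach o h)

  -- Subsets of edges (e.g. spanning trees) as Bool-valued functions on
  -- half-edges (both halves of an edge carry the same value).

  -- one step of the tour of T: a half-edge h in T is followed (we arrive
  -- at the other end and continue after α h), otherwise it is crossed.
  tourStep : (Fin m → Bool) → Fin m → Fin m
  tourStep T h = if T h then σ (α h) else σ h

  tour : (Fin m → Bool) → ℕ → Fin m
  tour T j = iter (tourStep T) j root

  Precedes : (Fin m → Bool) → Fin m → Fin m → Set
  Precedes T h h' = ∃ λ j → tour T j ≡ h × (∀ i → i ≤ j → tour T i ≢ h')

  data ReachUsing (P : Fin m → Set) : Fin m → Set where
    start : ReachUsing P root
    turn  : ∀ {h} → ReachUsing P h → ReachUsing P (σ h)
    cross : ∀ {h} → ReachUsing P h → P h → ReachUsing P (α h)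

  -- An edge h of T points away from the root-vertex: h is
  -- its tail iff the vertex of h is still connected to the root-vertex in
  -- T minus that edge.
  DeltaTail : (Fin m → Bool) → Fin m → Set
  DeltaTail T h =
      (T h ≡ true × ReachUsing (λ g → T g ≡ true × g ≢ h × g ≢ α h) h)
    ⊎ (T h ≡ false × Precedes T (α h) h)

  record GState : Set where
    constructor gstate
    field
      tree : Fin m → Bool
      seen : Fin m → Bool
      cur  : Fin m

  module _ (o : Orientation) where
    open Orientation o

    γstep : GState → GState
    γstep (gstate T S h) =
      let S'  = update S h true
          add = not (head h) ∧ not (S (α h))
          T'  = if add then update (update T h true) (α h) true else T
      in gstate T' S' (tourStep T' h)

    -- run until the tour is back at the root (fuel m suffices: the tour
    -- of a spanning tree encounters each of the m half-edges once)
    γrun : ℕ → GState → GState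
    γrun zero    s = s
    γrun (suc n) s with γstep s
    ... | s' = if does (GState.cur s' ≟ root) then s' else γrun n s'

    γ : Fin m → Bool
    γ = GState.tree (γrun m (gstate (λ _ → false) (λ _ → false) root))

{-# OPTIONS --safe #-}
-- γ builds its tree T along the tour of T itself: the tree status of a half-edge is settled when
-- the tour first meets it, so the run of γ is the tour of T up to its first return to the root.
-- A non-tree edge met at its tail was not added, so its head had been met before: this is the
-- δ orientation. The heart of the proof is that each edge added by γ leads to a vertex not met so
-- far. Otherwise the tree path from that vertex to the tail of the new edge closes, with that
-- edge, a directed cycle, and as the tour so far crossed only non-tree edges, the root lies on its
-- right: a positive cycle. Consequently every vertex carries at most one tree head and the root
-- vertex none, so T is directed away from the root and the tour explores each subtree in one go;
-- with reachability from the root this makes the tour meet every half-edge.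

module Submission where

open import Defs
open import Data.Nat using (ℕ; zero; suc; _+_; _∸_; _≤_; _<_; _≤′_; ≤′-step; ≤′-refl; z≤n; s≤s)
open import Data.Nat.Properties hiding (_≟_)
import Data.Nat.Properties as ℕ
open import Data.Nat.Induction using (<-rec)
open import Data.Fin using (Fin; toℕ; _≟_)
import Data.Fin.Properties as Fin
open import Data.Bool using (Bool; true; false; not; _∧_; if_then_else_)
open import Data.Bool.Properties using (not-¬; ¬-not)
open import Data.Product using (∃; _×_; _,_; proj₁; proj₂)
open import Data.Sum using (_⊎_; inj₁; inj₂)
open import Data.Empty using (⊥-elim)
open import Relation.Nullary using (¬_; does; yes; no)
open import Relation.Nullary.Decidable using (dec-true; dec-false)
open import Relation.Binary.PropositionalEquality
open import Relation.Binary.Definitions using (tri<; tri≈; tri>)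
open import Function.Bundles using (_⇔_; mk⇔)

module _ {A : Set} where

  iter-+ : (f : A → A) (a b : ℕ) (x : A) → iter f (a + b) x ≡ iter f a (iter f b x)
  iter-+ f zero    b x = refl
  iter-+ f (suc a) b x = cong f (iter-+ f a b x)

  iter-commute : (f : A → A) (n : ℕ) (x : A) → iter f n (f x) ≡ f (iter f n x)
  iter-commute f zero    x = refl
  iter-commute f (suc n) x = cong f (iter-commute f n x)

  module _ {f g : A → A} (g∘f≗id : ∀ x → g (f x) ≡ x) where

    iter-cancel : ∀ n x → iter g n (iter f n x) ≡ x
    iter-cancel zero    x = refl
    iter-cancel (suc n) x = begin
      g (iter g n (f (iter f n x)))  ≡⟨ iter-commute g n (f (iter f n x)) ⟨
      iter g n (g (f (iter f n x)))  ≡⟨ cong (iter g n) (g∘f≗id (iter f n x)) ⟩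
      iter g n (iter f n x)          ≡⟨ iter-cancel n x ⟩
      x                              ∎
      where open ≡-Reasoning

    iter-injective : ∀ n {x y} → iter f n x ≡ iter f n y → x ≡ y
    iter-injective n {x} {y} e =
      trans (sym (iter-cancel n x)) (trans (cong (iter g n) e) (iter-cancel n y))

iter-period : {m : ℕ} {f g : Fin m → Fin m} → (∀ x → g (f x) ≡ x) →
  ∀ a → ∃ λ p → 1 ≤ p × p ≤ m × iter f p a ≡ a
iter-period {m} {f} {g} g∘f≗id a
  with i , j , i<j , fⁱa≡fʲa ← Fin.pigeonhole (n<1+n m) (λ i → iter f (toℕ i) a) =
  p , m<n⇒0<n∸m i<j , p≤m ,
  sym (iter-injective {g = g} g∘f≗id (toℕ i) (trans fⁱa≡fʲa fʲa≡fⁱfᵖa))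
  where
  p : ℕ
  p = toℕ j ∸ toℕ i
  p≤m : p ≤ m
  p≤m = ≤-trans (m∸n≤m (toℕ j) (toℕ i)) (≤-pred (Fin.toℕ<n j))
  fʲa≡fⁱfᵖa : iter f (toℕ j) a ≡ iter f (toℕ i) (iter f p a)
  fʲa≡fⁱfᵖa =
    trans (cong (λ q → iter f q a) (sym (m+[n∸m]≡n (<⇒≤ i<j)))) (iter-+ f (toℕ i) p a)

upward-closed : {P : ℕ → Set} → (∀ {j} → P j → P (suc j)) → ∀ {j k} → j ≤ k → P j → P k
upward-closed {P} step j≤k = climb (≤⇒≤′ j≤k)
  where
  climb : ∀ {j k} → j ≤′ k → P j → P k
  climb ≤′-refl       p = p
  climb (≤′-step j≤k) p = step (climb j≤k p)

stepwise-monotone : (f : ℕ → ℕ) → ∀ {x y} → (∀ l → x ≤ l → l < y → f l ≤ f (suc l)) →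
  x ≤ y → f x ≤ f y
stepwise-monotone f {x} step x≤y = climb (≤⇒≤′ x≤y) step
  where
  climb : ∀ {y} → x ≤′ y → (∀ l → x ≤ l → l < y → f l ≤ f (suc l)) → f x ≤ f y
  climb ≤′-refl        _    = ≤-refl
  climb (≤′-step x≤y) step =
    ≤-trans (climb x≤y (λ l x≤l l<y → step l x≤l (m≤n⇒m≤1+n l<y)))
            (step _ (≤′⇒≤ x≤y) ≤-refl)

not∧not≡true : ∀ x y → not x ∧ not y ≡ true → x ≡ false × y ≡ false
not∧not≡true false false _ = refl , refl

not∧not≡false : ∀ x y → not x ∧ not y ≡ false → x ≡ false → y ≡ true
not∧not≡false false true _ _ = refl

not∧not-intro : ∀ {x y} → x ≡ false → y ≡ false → not x ∧ not y ≡ true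
not∧not-intro refl refl = refl

≡-by-true : {x y : Bool} → (x ≡ true → y ≡ true) → (y ≡ true → x ≡ true) → x ≡ y
≡-by-true {false} {false} _ _ = refl
≡-by-true {false} {true}  _ g = g refl
≡-by-true {true}  {false} f _ = sym (f refl)
≡-by-true {true}  {true}  _ _ = refl

bool-cases : (b : Bool) → b ≡ true ⊎ b ≡ false
bool-cases true  = inj₁ refl
bool-cases false = inj₂ refl

if-true : {A : Set} {b : Bool} {x y : A} → b ≡ true → (if b then x else y) ≡ x
if-true refl = refl

if-false : {A : Set} {b : Bool} {x y : A} → b ≡ false → (if b then x else y) ≡ y
if-false refl = refl

module _ {m : ℕ} where

  update-same : {B : Set} (f : Fin m → B) (x : Fin m) (b : B) → update f x b x ≡ b
  update-same f x b = if-true (dec-true (x ≟ x) refl)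

  update-≡true : (f : Fin m → Bool) (x y : Fin m) → update f x true y ≡ true → y ≡ x ⊎ f y ≡ true
  update-≡true f x y e with y ≟ x
  ... | yes y≡x = inj₁ y≡x
  ... | no  _   = inj₂ e

  update-mono : (f : Fin m → Bool) (x y : Fin m) → f y ≡ true → update f x true y ≡ true
  update-mono f x y e with y ≟ x
  ... | yes _ = refl
  ... | no  _ = e

module MapProperties {m : ℕ} (M : Map m) where
  open Map M

  infix 4 _∼_
  _∼_ : Fin m → Fin m → Set
  _∼_ = SameVertex M

  ∼-refl : ∀ {g} → g ∼ g
  ∼-refl = 0 , refl

  ∼-trans : ∀ {a b c} → a ∼ b → b ∼ c → a ∼ c
  ∼-trans {a} (k , refl) (k′ , refl) = k′ + k , iter-+ σ k′ k a

  ∼-σ : ∀ g → g ∼ σ g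
  ∼-σ g = 1 , refl

  σ⁻-∼ : ∀ g → σ⁻ g ∼ g
  σ⁻-∼ g = 1 , σσ⁻ g

  σ-∼ : ∀ g → σ g ∼ g
  σ-∼ g with iter-period {g = σ⁻} σ⁻σ g
  ... | suc p , _ , _ , σᵖ⁺¹g≡g = p , trans (iter-commute σ p g) σᵖ⁺¹g≡g

  ∼-sym : ∀ {a b} → a ∼ b → b ∼ a
  ∼-sym {a} (k , refl) = iter-∼ k
    where
    iter-∼ : ∀ k → iter σ k a ∼ a
    iter-∼ zero    = ∼-refl
    iter-∼ (suc k) = ∼-trans (σ-∼ (iter σ k a)) (iter-∼ k)

  ∼⇒σ⁻-iter : ∀ {x y} → x ∼ y → ∃ λ k → iter σ⁻ k x ≡ y
  ∼⇒σ⁻-iter {y = y} x∼y with ∼-sym x∼y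
  ... | k , refl = k , iter-cancel σ⁻σ k y

  α-injective : ∀ {x y} → α x ≡ α y → x ≡ y
  α-injective {x} {y} e = trans (sym (α-invol x)) (trans (cong α e) (α-invol y))

  tourStep-tree : ∀ T h → T h ≡ true → tourStep M T h ≡ σ (α h)
  tourStep-tree T h = if-true

  tourStep-nontree : ∀ T h → T h ≡ false → tourStep M T h ≡ σ h
  tourStep-nontree T h = if-false

  tourStep-cong : ∀ T T′ h → T h ≡ T′ h → tourStep M T h ≡ tourStep M T′ h
  tourStep-cong T T′ h e = cong (λ b → if b then σ (α h) else σ h) e

  tourStep⁻ : (Fin m → Bool) → Fin m → Fin m
  tourStep⁻ T g = if T (σ⁻ g) then α (σ⁻ g) else σ⁻ g

  module _ (T : Fin m → Bool) (T-α : ∀ g → T (α g) ≡ T g) where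

    tourStep⁻-tourStep : ∀ h → tourStep⁻ T (tourStep M T h) ≡ h
    tourStep⁻-tourStep h with T h in e
    ... | true  rewrite σ⁻σ (α h) | T-α h | e = α-invol h
    ... | false rewrite σ⁻σ h | e = refl

    tourStep-injective : ∀ {x y} → tourStep M T x ≡ tourStep M T y → x ≡ y
    tourStep-injective {x} {y} e =
      trans (sym (tourStep⁻-tourStep x)) (trans (cong (tourStep⁻ T) e) (tourStep⁻-tourStep y))

  reachUsing-mono : ∀ {P Q : Fin m → Set} → (∀ {g} → P g → Q g) →
    ∀ {h} → ReachUsing M P h → ReachUsing M Q h
  reachUsing-mono P⇒Q start       = start
  reachUsing-mono P⇒Q (turn r)    = turn (reachUsing-mono P⇒Q r)
  reachUsing-mono P⇒Q (cross r p) = cross (reachUsing-mono P⇒Q r) (P⇒Q p)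

module GammaRun {m : ℕ} (M : Map m) (o : Orientation M) where
  open Map M
  open Orientation o
  open MapProperties M

  state : ℕ → GState M
  state j = iter (γstep M o) j (gstate (λ _ → false) (λ _ → false) root)

  cur : ℕ → Fin m
  cur j = GState.cur (state j)

  tree seen : ℕ → Fin m → Bool
  tree j = GState.tree (state j)
  seen j = GState.seen (state j)

  adds : ℕ → Bool
  adds j = not (head (cur j)) ∧ not (seen j (α (cur j)))

  tree-suc : ∀ j → tree (suc j) ≡
    (if adds j then update (update (tree j) (cur j) true) (α (cur j)) true else tree j)
  tree-suc j = refl

  adds⇒ : ∀ {j} → adds j ≡ true → head (cur j) ≡ false × seen j (α (cur j)) ≡ false
  adds⇒ {j} = not∧not≡true (head (cur j)) (seen j (α (cur j)))

  ¬adds⇒ : ∀ {j} → adds j ≡ false → head (cur j) ≡ false → seen j (α (cur j)) ≡ true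
  ¬adds⇒ {j} = not∧not≡false (head (cur j)) (seen j (α (cur j)))

  α-head : ∀ {g} → head g ≡ false → head (α g) ≡ true
  α-head {g} tail = trans (head-α g) (cong not tail)

  α-tail : ∀ {g} → head g ≡ true → head (α g) ≡ false
  α-tail {g} hd = trans (head-α g) (cong not hd)

  added-head : ∀ {i} → adds i ≡ true → head (α (cur i)) ≡ true
  added-head {i} a = α-head (proj₁ (adds⇒ {i} a))

  cur-suc-tree : ∀ j → tree (suc j) (cur j) ≡ true → cur (suc j) ≡ σ (α (cur j))
  cur-suc-tree j = tourStep-tree (tree (suc j)) (cur j)

  cur-suc-nontree : ∀ j → tree (suc j) (cur j) ≡ false → cur (suc j) ≡ σ (cur j)
  cur-suc-nontree j = tourStep-nontree (tree (suc j)) (cur j)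

  seen⇒visited : ∀ j {g} → seen j g ≡ true → ∃ λ a → a < j × cur a ≡ g
  seen⇒visited (suc j) {g} e with update-≡true (seen j) (cur j) g e
  ... | inj₁ g≡cur = j , ≤-refl , sym g≡cur
  ... | inj₂ e′ with a , a<j , cur≡g ← seen⇒visited j e′ = a , m≤n⇒m≤1+n a<j , cur≡g

  seen-mono : ∀ {j k g} → j ≤ k → seen j g ≡ true → seen k g ≡ true
  seen-mono {g = g} = upward-closed {P = λ j → seen j g ≡ true} (λ {j} → update-mono (seen j) (cur j) g)

  visited⇒seen : ∀ {a j} → a < j → seen j (cur a) ≡ true
  visited⇒seen {a} a<j = seen-mono a<j (update-same (seen a) (cur a) true)

  tree⇒added : ∀ j {g} → tree j g ≡ true →
    ∃ λ i → i < j × adds i ≡ true × (g ≡ cur i ⊎ g ≡ α (cur i))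
  tree⇒added (suc j) {g} e rewrite tree-suc j with adds j in a
  ... | false with i , i<j , aᵢ , g≡ ← tree⇒added j e = i , m≤n⇒m≤1+n i<j , aᵢ , g≡
  ... | true with update-≡true (update (tree j) (cur j) true) (α (cur j)) g e
  ...   | inj₁ g≡αcur = j , ≤-refl , a , inj₂ g≡αcur
  ...   | inj₂ e′ with update-≡true (tree j) (cur j) g e′
  ...     | inj₁ g≡cur = j , ≤-refl , a , inj₁ g≡cur
  ...     | inj₂ e″ with i , i<j , aᵢ , g≡ ← tree⇒added j e″ = i , m≤n⇒m≤1+n i<j , aᵢ , g≡

  tree-step : ∀ j g → tree j g ≡ true → tree (suc j) g ≡ true
  tree-step j g e rewrite tree-suc j with adds j
  ... | false = e
  ... | true  = update-mono (update (tree j) (cur j) true) (α (cur j)) g (update-mono (tree j) (cur j) g e)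

  tree-mono : ∀ {j k g} → j ≤ k → tree j g ≡ true → tree k g ≡ true
  tree-mono {g = g} = upward-closed {P = λ j → tree j g ≡ true} (λ {j} → tree-step j g)

  added⇒tree : ∀ {i j} → adds i ≡ true → i < j →
    tree j (cur i) ≡ true × tree j (α (cur i)) ≡ true
  added⇒tree {i} a i<j = tree-mono i<j tail-added , tree-mono i<j head-added
    where
    grown : tree (suc i) ≡ update (update (tree i) (cur i) true) (α (cur i)) true
    grown = trans (tree-suc i) (if-true a)
    tail-added : tree (suc i) (cur i) ≡ true
    tail-added rewrite grown =
      update-mono (update (tree i) (cur i) true) (α (cur i)) (cur i) (update-same (tree i) (cur i) true)
    head-added : tree (suc i) (α (cur i)) ≡ true
    head-added rewrite grown = update-same (update (tree i) (cur i) true) (α (cur i)) true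

  added-edge⇒tree : ∀ {i n g} → adds i ≡ true → i < n → g ≡ cur i ⊎ g ≡ α (cur i) →
    tree n g ≡ true
  added-edge⇒tree a i<n (inj₁ refl) = proj₁ (added⇒tree a i<n)
  added-edge⇒tree a i<n (inj₂ refl) = proj₂ (added⇒tree a i<n)

  tree-α⇒ : ∀ j g → tree j (α g) ≡ true → tree j g ≡ true
  tree-α⇒ j g t with i , i<j , a , αg≡ ← tree⇒added j t =
    added-edge⇒tree {i} {j} a i<j (swap {i} αg≡)
    where
    swap : ∀ {i} → α g ≡ cur i ⊎ α g ≡ α (cur i) → g ≡ cur i ⊎ g ≡ α (cur i)
    swap (inj₁ αg≡cur)  = inj₂ (trans (sym (α-invol g)) (cong α αg≡cur))
    swap (inj₂ αg≡αcur) = inj₁ (α-injective αg≡αcur)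

  tree-α : ∀ j g → tree j (α g) ≡ tree j g
  tree-α j g = ≡-by-true (tree-α⇒ j g) λ t →
    tree-α⇒ j (α g) (subst (λ x → tree j x ≡ true) (sym (α-invol g)) t)

  TreeHead : ℕ → Fin m → Set
  TreeHead n g = tree n g ≡ true × head g ≡ true

  added⇒treeHead : ∀ {i n} → adds i ≡ true → i < n → TreeHead n (α (cur i))
  added⇒treeHead {i} a i<n = proj₂ (added⇒tree {i} a i<n) , added-head {i} a

  treeHead⇒added : ∀ n {g} → TreeHead n g → ∃ λ i → i < n × adds i ≡ true × g ≡ α (cur i)
  treeHead⇒added n (t , h) with tree⇒added n t
  ... | i , i<n , a , inj₂ g≡αcur = i , i<n , a , g≡αcur
  ... | i , i<n , a , inj₁ g≡cur  = ⊥-elim (not-¬ h (trans (cong head g≡cur) (proj₁ (adds⇒ {i} a))))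

  treeTail⇒added : ∀ n {g} → tree n g ≡ true → head g ≡ false →
    ∃ λ i → i < n × adds i ≡ true × g ≡ cur i
  treeTail⇒added n t h with tree⇒added n t
  ... | i , i<n , a , inj₁ g≡cur  = i , i<n , a , g≡cur
  ... | i , i<n , a , inj₂ g≡αcur = ⊥-elim (not-¬ (trans (cong head g≡αcur) (added-head {i} a)) h)

  added-head-unvisited : ∀ {i j} → adds i ≡ true → j < i → cur j ≢ α (cur i)
  added-head-unvisited {i} a j<i e =
    not-¬ (subst (λ x → seen i x ≡ true) e (visited⇒seen j<i)) (proj₂ (adds⇒ {i} a))

  revisit-added : ∀ {i j} → adds i ≡ true → j < i → cur j ≡ cur i → tree (suc j) (cur j) ≡ true
  revisit-added {i} {j} a j<i e = proj₁ (added⇒tree {j} (not∧not-intro tail unseen) ≤-refl)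
    where
    tail : head (cur j) ≡ false
    tail = trans (cong head e) (proj₁ (adds⇒ {i} a))
    unseen : seen j (α (cur j)) ≡ false
    unseen = ¬-not λ s →
      not-¬ (seen-mono (<⇒≤ j<i) (subst (λ x → seen j (α x) ≡ true) e s)) (proj₂ (adds⇒ {i} a))

  tree-settled : ∀ {j k} → suc j ≤ k → tree k (cur j) ≡ tree (suc j) (cur j)
  tree-settled {j} {k} j<k = ≡-by-true settled (tree-mono j<k)
    where
    settled : tree k (cur j) ≡ true → tree (suc j) (cur j) ≡ true
    settled t with i , _ , a , cur≡ ← tree⇒added k t with i ≤? j | cur≡
    ... | yes i≤j | _               = added-edge⇒tree a (s≤s i≤j) cur≡
    ... | no  i≰j | inj₁ cur≡cur    = revisit-added a (≰⇒> i≰j) cur≡cur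
    ... | no  i≰j | inj₂ cur≡αcur   = ⊥-elim (added-head-unvisited a (≰⇒> i≰j) cur≡αcur)

  cur-suc : ∀ {j k} → suc j ≤ k → cur (suc j) ≡ tourStep M (tree k) (cur j)
  cur-suc {j} {k} j<k = tourStep-cong (tree (suc j)) (tree k) (cur j) (sym (tree-settled j<k))

  cur-suc-added : ∀ {i} → adds i ≡ true → cur (suc i) ≡ σ (α (cur i))
  cur-suc-added {i} a = cur-suc-tree i (proj₁ (added⇒tree {i} a ≤-refl))

  tour≡cur : ∀ {j k} → j ≤ k → tour M (tree k) j ≡ cur j
  tour≡cur {zero}      _   = refl
  tour≡cur {suc j} {k} j<k = trans (cong (tourStep M (tree k)) (tour≡cur (<⇒≤ j<k))) (sym (cur-suc j<k))

  -- The tour enters a vertex only at the root or just after a tree head, and then turns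
  -- counterclockwise around it.
  visited-σ⁻ : ∀ a → cur a ≢ root → ¬ TreeHead a (σ⁻ (cur a)) → seen a (σ⁻ (cur a)) ≡ true
  visited-σ⁻ zero    nonroot _ = ⊥-elim (nonroot refl)
  visited-σ⁻ (suc b) _ notHead with bool-cases (tree (suc b) (cur b))
  ... | inj₂ nontree = subst (λ x → seen (suc b) x ≡ true) (sym before≡) (visited⇒seen {b} ≤-refl)
    where
    before≡ : σ⁻ (cur (suc b)) ≡ cur b
    before≡ = trans (cong σ⁻ (cur-suc-nontree b nontree)) (σ⁻σ (cur b))
  ... | inj₁ intree = subst (λ x → seen (suc b) x ≡ true) (sym before≡) seen-α
    where
    before≡ : σ⁻ (cur (suc b)) ≡ α (cur b)
    before≡ = trans (cong σ⁻ (cur-suc-tree b intree)) (σ⁻σ (α (cur b)))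
    αtree : tree (suc b) (α (cur b)) ≡ true
    αtree = trans (tree-α (suc b) (cur b)) intree
    seen-α : seen (suc b) (α (cur b)) ≡ true
    seen-α with tree⇒added (suc b) αtree
    ... | i , i<sb , _ , inj₁ αcur≡cur  =
      subst (λ x → seen (suc b) x ≡ true) (sym αcur≡cur) (visited⇒seen i<sb)
    ... | i , i<sb , a , inj₂ αcur≡αcur =
      ⊥-elim (notHead (subst (TreeHead (suc b)) (trans (sym αcur≡αcur) (sym before≡))
                               (added⇒treeHead {i} a i<sb)))

  seen-σ⁻ : ∀ j {g} → seen j g ≡ true → g ≢ root → ¬ TreeHead j (σ⁻ g) →
    seen j (σ⁻ g) ≡ true
  seen-σ⁻ j s nonroot notHead with a , a<j , refl ← seen⇒visited j s =
    seen-mono (<⇒≤ a<j) (visited-σ⁻ a nonroot (λ (t , h) → notHead (tree-mono (<⇒≤ a<j) t , h)))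

  RootHeadless UniqueTreeHead : ℕ → Set
  RootHeadless n   = ∀ {g} → TreeHead n g → ¬ root ∼ g
  UniqueTreeHead n = ∀ {g g′} → TreeHead n g → TreeHead n g′ → g ∼ g′ → g ≡ g′

  -- Walking clockwise from a seen tree head x we only meet seen half-edges, until we are back at σ x.
  treeHead-vertex-seen : ∀ {n} → RootHeadless n → UniqueTreeHead n →
    ∀ {x g} → TreeHead n x → seen n x ≡ true → x ∼ g → seen n g ≡ true
  treeHead-vertex-seen {n} headless unique {x} x-head x-seen x∼g
    with k , refl ← ∼⇒σ⁻-iter x∼g = around k
    where
    around : ∀ k → seen n (iter σ⁻ k x) ≡ true
    around zero = x-seen
    around (suc k) with iter σ⁻ k x ≟ σ x
    ... | yes y≡σx = subst (λ z → seen n z ≡ true) (sym (trans (cong σ⁻ y≡σx) (σ⁻σ x))) x-seen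
    ... | no  y≢σx = seen-σ⁻ n (around k) nonroot notHead
      where
      y : Fin m
      y = iter σ⁻ k x
      y∼x : y ∼ x
      y∼x = k , iter-cancel σσ⁻ k x
      nonroot : y ≢ root
      nonroot y≡root = headless x-head (subst (_∼ x) y≡root y∼x)
      notHead : ¬ TreeHead n (σ⁻ y)
      notHead σ⁻y-head =
        y≢σx (trans (sym (σσ⁻ y)) (cong σ (unique σ⁻y-head x-head (∼-trans (σ⁻-∼ y) y∼x))))

  Fresh : ℕ → Set
  Fresh i = adds i ≡ true → ∀ {g} → α (cur i) ∼ g → seen (suc i) g ≡ false

  FreshBefore : ℕ → Set
  FreshBefore n = ∀ {i} → i < n → Fresh i

  fresh⇒unvisited : ∀ {z x} → Fresh z → adds z ≡ true → x ≤ z → ¬ α (cur z) ∼ cur x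
  fresh⇒unvisited fresh a x≤z s = not-¬ (visited⇒seen (s≤s x≤z)) (fresh a s)

  module _ {n : ℕ} (freshBefore : FreshBefore n) where

    rootHeadless : RootHeadless n
    rootHeadless th root∼g with i , i<n , a , refl ← treeHead⇒added n th =
      fresh⇒unvisited {i} (freshBefore i<n) a z≤n (∼-sym root∼g)

    earlier-heads-apart : ∀ {i i′} → i < i′ → i′ < n → adds i ≡ true → adds i′ ≡ true →
      ¬ α (cur i) ∼ α (cur i′)
    earlier-heads-apart {i} i<i′ i′<n a a′ s =
      fresh⇒unvisited (freshBefore i′<n) a′ i<i′ (∼-trans (∼-sym s) αcur∼next)
      where
      αcur∼next : α (cur i) ∼ cur (suc i)
      αcur∼next = subst (α (cur i) ∼_) (sym (cur-suc-added {i} a)) (∼-σ _)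

    uniqueTreeHead : UniqueTreeHead n
    uniqueTreeHead th th′ s with treeHead⇒added n th | treeHead⇒added n th′
    ... | i , i<n , a , refl | i′ , i′<n , a′ , refl with <-cmp i i′
    ... | tri< i<i′ _ _ = ⊥-elim (earlier-heads-apart i<i′ i′<n a a′ s)
    ... | tri≈ _ refl _ = refl
    ... | tri> _ _ i′<i = ⊥-elim (earlier-heads-apart i′<i i<n a′ a (∼-sym s))

  -- Desc n i g: in the tree at time n, the vertex of g lies in the subtree below the head
  -- of the edge added at time i.
  data Desc (n i : ℕ) : Fin m → Set where
    base  : ∀ {g} → α (cur i) ∼ g → Desc n i g
    child : ∀ {g} τ → Desc n i (cur τ) → adds τ ≡ true → τ < n → α (cur τ) ∼ g → Desc n i g

  desc-∼ : ∀ {n i g g′} → Desc n i g → g ∼ g′ → Desc n i g′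
  desc-∼ (base s)             s′ = base (∼-trans s s′)
  desc-∼ (child τ d a τ<n s) s′ = child τ d a τ<n (∼-trans s s′)

  desc-tourStep : ∀ {n i h} → UniqueTreeHead n → Desc n i h →
    Desc n i (tourStep M (tree n) h) ⊎ (TreeHead n h × α (cur i) ∼ h)
  desc-tourStep {n} {i} {h} unique d with bool-cases (tree n h) | bool-cases (head h)
  ... | inj₂ nontree | _ =
    inj₁ (subst (Desc n i) (sym (tourStep-nontree (tree n) h nontree)) (desc-∼ d (∼-σ h)))
  ... | inj₁ intree | inj₂ tail with τ , τ<n , a , refl ← treeTail⇒added n intree tail =
    inj₁ (subst (Desc n i) (sym (tourStep-tree (tree n) h intree)) (child τ d a τ<n (∼-σ _)))
  ... | inj₁ intree | inj₁ hd with d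
  ...   | base s = inj₂ ((intree , hd) , s)
  ...   | child τ d′ a τ<n s =
    inj₁ (subst (Desc n i) (sym (tourStep-tree (tree n) h intree))
                (subst (λ x → Desc n i (σ x)) parent (desc-∼ d′ (∼-σ _))))
    where
    parent : cur τ ≡ α h
    parent = trans (sym (α-invol (cur τ))) (cong α (unique (added⇒treeHead {τ} a τ<n) (intree , hd) s))

  desc-after-added : ∀ {n i} → adds i ≡ true → Desc n i (cur (suc i))
  desc-after-added {i = i} a = base (subst (α (cur i) ∼_) (sym (cur-suc-added {i} a)) (∼-σ _))

  LeftBelow : ℕ → ℕ → ℕ → Set
  LeftBelow n i b = ∃ λ x → x < b × TreeHead n (cur x) × α (cur i) ∼ cur x

  desc-walk : ∀ {n i a b} → UniqueTreeHead n → a ≤ b → b ≤ n → Desc n i (cur a) →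
    Desc n i (cur b) ⊎ LeftBelow n i b
  desc-walk {n} {i} {a} unique a≤b b≤n d = climb (≤⇒≤′ a≤b) b≤n
    where
    climb : ∀ {b} → a ≤′ b → b ≤ n → Desc n i (cur b) ⊎ LeftBelow n i b
    climb ≤′-refl _ = inj₁ d
    climb (≤′-step {b} a≤b) b<n with climb a≤b (<⇒≤ b<n)
    ... | inj₂ (x , x<b , exit) = inj₂ (x , m≤n⇒m≤1+n x<b , exit)
    ... | inj₁ d_b with desc-tourStep unique d_b
    ...   | inj₁ d′   = inj₁ (subst (Desc n i) (sym (cur-suc b<n)) d′)
    ...   | inj₂ exit = inj₂ (b , ≤-refl , exit)

  depth : ∀ {n i g} → Desc n i g → ℕ
  depth (base _)          = 0
  depth (child _ d _ _ _) = suc (depth d)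

  -- Times of the edges on the tree path: position 0 is the edge i itself, position depth d the
  -- last edge.
  edgeAt : ∀ {n i g} → Desc n i g → ℕ → ℕ
  edgeAt {i = i} (base _) _ = i
  edgeAt (child τ d _ _ _) l = if does (l ℕ.≟ suc (depth d)) then τ else edgeAt d l

  module _ {n i : ℕ} where

    edgeAt-last : ∀ {g τ} (d : Desc n i (cur τ)) a τ<n (s : α (cur τ) ∼ g) →
      edgeAt (child τ d a τ<n s) (suc (depth d)) ≡ τ
    edgeAt-last d _ _ _ = if-true (dec-true (suc (depth d) ℕ.≟ suc (depth d)) refl)

    edgeAt-below : ∀ {g τ} (d : Desc n i (cur τ)) a τ<n (s : α (cur τ) ∼ g) →
      ∀ {l} → l ≤ depth d → edgeAt (child τ d a τ<n s) l ≡ edgeAt d l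
    edgeAt-below d _ _ _ {l} l≤ =
      if-false (dec-false (l ℕ.≟ suc (depth d)) (λ e → 1+n≰n (subst (_≤ depth d) e l≤)))

    edgeAt-zero : ∀ {g} (d : Desc n i g) → edgeAt d 0 ≡ i
    edgeAt-zero (base _)            = refl
    edgeAt-zero (child τ d a τ<n s) = trans (edgeAt-below d a τ<n s z≤n) (edgeAt-zero d)

    edgeAt-added : ∀ {g} (d : Desc n i g) {l} → 1 ≤ l → l ≤ depth d →
      adds (edgeAt d l) ≡ true × edgeAt d l < n
    edgeAt-added (base _) (s≤s _) ()
    edgeAt-added (child τ d a τ<n s) {l} 1≤l l≤ with m≤n⇒m<n∨m≡n l≤
    ... | inj₂ refl = subst (λ x → adds x ≡ true × x < n) (sym (edgeAt-last d a τ<n s)) (a , τ<n)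
    ... | inj₁ l<   = subst (λ x → adds x ≡ true × x < n) (sym (edgeAt-below d a τ<n s (≤-pred l<)))
                        (edgeAt-added d 1≤l (≤-pred l<))

    desc-end : ∀ {g} (d : Desc n i g) → α (cur (edgeAt d (depth d))) ∼ g
    desc-end (base s)            = s
    desc-end (child τ d a τ<n s) = subst (λ x → α (cur x) ∼ _) (sym (edgeAt-last d a τ<n s)) s

    desc-chain : ∀ {g} (d : Desc n i g) {l} → l < depth d → α (cur (edgeAt d l)) ∼ cur (edgeAt d (suc l))
    desc-chain (child τ d a τ<n s) {l} l< with m≤n⇒m<n∨m≡n (≤-pred l<)
    ... | inj₁ l<d  = subst₂ (λ x y → α (cur x) ∼ cur y)
                        (sym (edgeAt-below d a τ<n s (<⇒≤ l<d))) (sym (edgeAt-below d a τ<n s l<d))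
                        (desc-chain d l<d)
    ... | inj₂ refl = subst₂ (λ x y → α (cur x) ∼ cur y)
                        (sym (edgeAt-below d a τ<n s ≤-refl)) (sym (edgeAt-last d a τ<n s)) (desc-end d)

  -- The tree path from the head of the new edge i down to its tail, closed by edge i, is a positive
  -- cycle: the tour so far crossed only non-tree edges, so it joins the root to the tail of edge i
  -- without crossing the cycle.
  module Cycle {i : ℕ} (freshBefore : FreshBefore i) (a : adds i ≡ true) (d : Desc i i (cur i)) where

    k : ℕ
    k = depth d

    τ : ℕ → ℕ
    τ = edgeAt d

    t : ℕ → Fin m
    t l = cur (τ l)

    t-zero : t 0 ≡ cur i
    t-zero = cong cur (edgeAt-zero d)

    τ-increasing : ∀ {l} → 1 ≤ l → l < k → τ l < τ (suc l)
    τ-increasing {l} 1≤l l<k with aₗ , τₗ<i ← edgeAt-added d 1≤l (<⇒≤ l<k) =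
      ≰⇒> (λ τ′≤τ → fresh⇒unvisited {τ l} (freshBefore τₗ<i) aₗ τ′≤τ (desc-chain d l<k))

    later-head-avoids : ∀ {x z} → 1 ≤ x → x ≤ z → z ≤ k → ¬ α (t z) ∼ t x
    later-head-avoids {x} {z} 1≤x x≤z z≤k with a′ , τz<i ← edgeAt-added d (≤-trans 1≤x x≤z) z≤k =
      fresh⇒unvisited {τ z} (freshBefore τz<i) a′ τ-monotone
      where
      τ-monotone : τ x ≤ τ z
      τ-monotone = stepwise-monotone τ
        (λ l x≤l l<z → <⇒≤ (τ-increasing (≤-trans 1≤x x≤l) (<-≤-trans l<z z≤k))) x≤z

    simple : ∀ x y → x < y → y ≤ k → ¬ t x ∼ t y
    simple zero    (suc y) _ y<k s =
      later-head-avoids (s≤s z≤n) y<k ≤-refl (∼-trans (desc-end d) (subst (_∼ t (suc y)) t-zero s))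
    simple (suc x) (suc y) (s≤s x<y) y<k s =
      later-head-avoids (s≤s z≤n) x<y (<⇒≤ y<k) (∼-trans (desc-chain d y<k) (∼-sym s))

    tails : ∀ x → x ≤ k → head (t x) ≡ false
    tails zero    _   = subst (λ h → head h ≡ false) (sym t-zero) (proj₁ (adds⇒ {i} a))
    tails (suc l) l<k = proj₁ (adds⇒ {τ (suc l)} (proj₁ (edgeAt-added d (s≤s z≤n) l<k)))

    OnCycle : Fin m → Set
    OnCycle h = ∃ λ l → l ≤ k × (h ≡ t l ⊎ h ≡ α (t l))

    off-cycle : ∀ {j} → j < i → tree (suc j) (cur j) ≡ false → ¬ OnCycle (cur j)
    off-cycle j<i nontree (zero , _ , inj₁ e) = not-¬ (revisit-added a j<i (trans e t-zero)) nontree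
    off-cycle j<i nontree (zero , _ , inj₂ e) = added-head-unvisited a j<i (trans e (cong α t-zero))
    off-cycle j<i nontree (suc l , l<k , e) with aₗ , τₗ<i ← edgeAt-added d (s≤s z≤n) l<k =
      not-¬ (trans (sym (tree-settled j<i)) (added-edge⇒tree {τ (suc l)} aₗ τₗ<i e)) nontree

    tour-region : ∀ j → j ≤ i → SameRegion M OnCycle root (cur j)
    tour-region zero    _   = refl-r
    tour-region (suc j) j<i with bool-cases (tree (suc j) (cur j))
    ... | inj₁ intree  = subst (SameRegion M OnCycle root) (sym (cur-suc-tree j intree))
                           (fwd (tour-region j (<⇒≤ j<i)) (alongEdge (cur j)))
    ... | inj₂ nontree = subst (SameRegion M OnCycle root) (sym (cur-suc-nontree j nontree))
                           (fwd (tour-region j (<⇒≤ j<i)) (crossEdge (cur j) (off-cycle j<i nontree)))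

    positiveCycle : PositiveCycle M o
    positiveCycle = record
      { k           = k
      ; t           = t
      ; tails       = tails
      ; chain       = λ _ → desc-chain d
      ; close       = subst (α (t k) ∼_) (sym t-zero) (desc-end d)
      ; simple      = simple
      ; rootOnRight = subst (λ h → SameRegion M OnCycle root (σ (α h))) (sym t-zero)
                        (fwd (tour-region i ≤-refl) (alongEdge (cur i)))
      }

  -- From an earlier visit of the new head vertex, the tour either stays below it up to the new
  -- tail, or leaves it through a tree head there, after which the whole vertex has been seen.
  noPositiveCycle⇒fresh : ¬ PositiveCycle M o → ∀ i → Fresh i
  noPositiveCycle⇒fresh noPositiveCycle = <-rec Fresh fresh-step
    where
    fresh-step : ∀ i → FreshBefore i → Fresh i
    fresh-step i freshBefore a {g} αcur∼g = ¬-not revisited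
      where
      revisited : seen (suc i) g ≢ true
      revisited g-seen with a₀ , a₀≤i , refl ← seen⇒visited (suc i) g-seen
                       with desc-walk (uniqueTreeHead freshBefore) (≤-pred a₀≤i) ≤-refl (base {i} {i} αcur∼g)
      ... | inj₁ d = noPositiveCycle (Cycle.positiveCycle freshBefore a d)
      ... | inj₂ (x , x<i , x-head , αcur∼x) =
        not-¬ (treeHead-vertex-seen {i} (rootHeadless freshBefore) (uniqueTreeHead freshBefore)
                 x-head (visited⇒seen x<i) (∼-sym αcur∼x))
              (proj₂ (adds⇒ {i} a))

  reach-cur : ∀ j → ReachUsing M (λ g → tree j g ≡ true) (cur j)
  reach-cur zero    = start
  reach-cur (suc j) with bool-cases (tree (suc j) (cur j))
  ... | inj₁ intree  = subst (ReachUsing M (λ g → tree (suc j) g ≡ true)) (sym (cur-suc-tree j intree))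
                         (turn (cross (reachUsing-mono (λ {g} → tree-step j g) (reach-cur j)) intree))
  ... | inj₂ nontree = subst (ReachUsing M (λ g → tree (suc j) g ≡ true)) (sym (cur-suc-nontree j nontree))
                         (turn (reachUsing-mono (λ {g} → tree-step j g) (reach-cur j)))

  γrun-state : ∀ n j → ∃ λ t → γrun M o n (state j) ≡ state t × t ≤ j + n ×
    (∀ t′ → j < t′ → t′ < t → cur t′ ≢ root) × (j < t × cur t ≡ root ⊎ t ≡ j + n)
  γrun-state zero j =
    j , refl , ≤-reflexive (sym (+-identityʳ j)) , (λ _ j<t′ t′<j → ⊥-elim (<-asym j<t′ t′<j)) ,
    inj₂ (sym (+-identityʳ j))
  γrun-state (suc n) j with cur (suc j) ≟ root
  ... | yes returned =
    suc j , refl , subst (suc j ≤_) (sym (+-suc j n)) (s≤s (m≤m+n j n)) ,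
    (λ _ j<t′ t′≤j → ⊥-elim (≤⇒≯ j<t′ t′≤j)) , inj₁ (≤-refl , returned)
  ... | no away with t , run≡ , t≤ , first , stop ← γrun-state n (suc j) =
    t , run≡ , subst (t ≤_) (sym (+-suc j n)) t≤ , first′ , stop′ stop
    where
    first′ : ∀ t′ → j < t′ → t′ < t → cur t′ ≢ root
    first′ t′ j<t′ t′<t with m≤n⇒m<n∨m≡n j<t′
    ... | inj₁ sj<t′ = first t′ sj<t′ t′<t
    ... | inj₂ refl  = away
    stop′ : suc j < t × cur t ≡ root ⊎ t ≡ suc j + n → j < t × cur t ≡ root ⊎ t ≡ j + suc n
    stop′ (inj₁ (sj<t , returned)) = inj₁ (<-trans (n<1+n j) sj<t , returned)
    stop′ (inj₂ t≡)                = inj₂ (trans t≡ (sym (+-suc j n)))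

  cur-returns : ∃ λ p → 1 ≤ p × p ≤ m × cur p ≡ root
  cur-returns
    with p , 1≤p , p≤m , tourᵖ≡root ← iter-period {f = tourStep M (tree m)} {g = tourStep⁻ (tree m)}
                                         (tourStep⁻-tourStep (tree m) (tree-α m)) root =
    p , 1≤p , p≤m , trans (sym (tour≡cur p≤m)) tourᵖ≡root

  first-return : ∃ λ L → γ M o ≡ tree L × 1 ≤ L × cur L ≡ root ×
    (∀ l → 1 ≤ l → l < L → cur l ≢ root)
  first-return with L , run≡ , L≤m , first , stop ← γrun-state m 0 =
    L , cong GState.tree run≡ , positive stop , returns stop , first
    where
    1≤m : 1 ≤ m
    1≤m = ≤-trans (s≤s z≤n) (Fin.toℕ<n root)
    positive : 0 < L × cur L ≡ root ⊎ L ≡ m → 1 ≤ L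
    positive (inj₁ (0<L , _)) = 0<L
    positive (inj₂ refl)      = 1≤m
    returns : 0 < L × cur L ≡ root ⊎ L ≡ m → cur L ≡ root
    returns (inj₁ (_ , returned)) = returned
    returns (inj₂ refl) with p , 1≤p , p≤m , curᵖ≡root ← cur-returns with p <? m
    ... | yes p<m = ⊥-elim (first p 1≤p p<m curᵖ≡root)
    ... | no  p≮m = subst (λ x → cur x ≡ root) (≤-antisym p≤m (≮⇒≥ p≮m)) curᵖ≡root

  module Traversal (noPositiveCycle : ¬ PositiveCycle M o) (reachable : ∀ h → DReach M o h)
                   {L : ℕ} (1≤L : 1 ≤ L) (returns : cur L ≡ root)
                   (first : ∀ l → 1 ≤ l → l < L → cur l ≢ root) where

    headless : ∀ {n} → RootHeadless n
    headless {n} = rootHeadless {n} (λ {i} _ → noPositiveCycle⇒fresh noPositiveCycle i)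

    unique : ∀ {n} → UniqueTreeHead n
    unique {n} = uniqueTreeHead {n} (λ {i} _ → noPositiveCycle⇒fresh noPositiveCycle i)

    cur-injective : ∀ {a b} → a < b → b < L → cur a ≢ cur b
    cur-injective {a} {b} a<b b<L e =
      first (b ∸ a) (m<n⇒0<n∸m a<b) (≤-<-trans (m∸n≤m b a) b<L)
        (sym (shift a b (<⇒≤ a<b) (<⇒≤ b<L) e))
      where
      shift : ∀ a b → a ≤ b → b ≤ L → cur a ≡ cur b → cur 0 ≡ cur (b ∸ a)
      shift zero    b       _         _   e = e
      shift (suc a) (suc b) (s≤s a≤b) b<L e =
        shift a b a≤b (<⇒≤ b<L) (tourStep-injective (tree L) (tree-α L) (begin
          tourStep M (tree L) (cur a)  ≡⟨ cur-suc (≤-trans (s≤s a≤b) b<L) ⟨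
          cur (suc a)                  ≡⟨ e ⟩
          cur (suc b)                  ≡⟨ cur-suc b<L ⟩
          tourStep M (tree L) (cur b)  ∎))
        where open ≡-Reasoning

    root-outside : ∀ {i} → adds i ≡ true → i < L → ¬ Desc L i root
    root-outside {i} a i<L (base s)         = headless {L} (added⇒treeHead {i} a i<L) (∼-sym s)
    root-outside _ _ (child τ _ a τ<L s) = headless {L} (added⇒treeHead {τ} a τ<L) (∼-sym s)

    Visited : Fin m → Set
    Visited g = ∃ λ b → b < L × cur b ≡ g

    -- After adding an edge the tour explores the subtree below it, which it can only leave
    -- through the head of that edge: the root, where the tour ends, is not below it.
    head-visited : ∀ {i} → adds i ≡ true → i < L → Visited (α (cur i))
    head-visited {i} a i<L with desc-walk (unique {L}) i<L ≤-refl (desc-after-added {L} {i} a)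
    ... | inj₁ d = ⊥-elim (root-outside a i<L (subst (Desc L i) returns d))
    ... | inj₂ (x , x<L , x-head , s) = x , x<L , sym (unique {L} (added⇒treeHead {i} a i<L) x-head s)

    visited-next : ∀ {b} → b < L → Visited (cur (suc b))
    visited-next {b} b<L with m≤n⇒m<n∨m≡n b<L
    ... | inj₁ sb<L = suc b , sb<L , refl
    ... | inj₂ refl = 0 , 1≤L , sym returns

    tree-visited-α : ∀ {g} → tree L g ≡ true → Visited (α g)
    tree-visited-α t with tree⇒added L t
    ... | i , i<L , a , inj₁ refl = head-visited a i<L
    ... | i , i<L , _ , inj₂ refl = i , i<L , sym (α-invol (cur i))

    visited-σ : ∀ {g} → Visited g → Visited (σ g)
    visited-σ (b , b<L , refl) with bool-cases (tree L (cur b))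
    ... | inj₂ nontree =
      subst Visited (trans (cur-suc b<L) (tourStep-nontree (tree L) (cur b) nontree)) (visited-next b<L)
    ... | inj₁ intree with b′ , b′<L , cur≡ ← tree-visited-α intree =
      subst Visited (trans (cur-suc b′<L) back) (visited-next b′<L)
      where
      back : tourStep M (tree L) (cur b′) ≡ σ (cur b)
      back = begin
        tourStep M (tree L) (cur b′)  ≡⟨ tourStep-tree (tree L) (cur b′) b′-tree ⟩
        σ (α (cur b′))                ≡⟨ cong (λ x → σ (α x)) cur≡ ⟩
        σ (α (α (cur b)))             ≡⟨ cong σ (α-invol (cur b)) ⟩
        σ (cur b)                     ∎
        where
        open ≡-Reasoning
        b′-tree : tree L (cur b′) ≡ true
        b′-tree = trans (cong (tree L) cur≡) (trans (tree-α L (cur b)) intree)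

    nontree⇒¬adds : ∀ {b} → b < L → tree L (cur b) ≡ false → adds b ≡ false
    nontree⇒¬adds {b} b<L nontree = ¬-not λ a → not-¬ (proj₁ (added⇒tree {b} a b<L)) nontree

    nontree-tail-after-head : ∀ {b g} → b < L → cur b ≡ g → tree L g ≡ false → head g ≡ false →
      ∃ λ a₀ → a₀ < b × cur a₀ ≡ α g
    nontree-tail-after-head {b} b<L refl nontree tail =
      seen⇒visited b (¬adds⇒ {b} (nontree⇒¬adds b<L nontree) tail)

    visited-α : ∀ {g} → Visited g → head g ≡ false → Visited (α g)
    visited-α (b , b<L , refl) tail with bool-cases (tree L (cur b))
    ... | inj₁ intree  = tree-visited-α intree
    ... | inj₂ nontree with a₀ , a₀<b , cur≡ ← nontree-tail-after-head b<L refl nontree tail =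
      a₀ , <-trans a₀<b b<L , cur≡

    reachable⇒visited : ∀ {h} → DReach M o h → Visited h
    reachable⇒visited start      = 0 , 1≤L , refl
    reachable⇒visited (turn r)   = visited-σ (reachable⇒visited r)
    reachable⇒visited (go r tail) = visited-α (reachable⇒visited r) tail

    added-edge-new : ∀ {i} → adds i ≡ true → i < L → tree i (cur i) ≡ false
    added-edge-new {i} a i<L = ¬-not earlier
      where
      earlier : tree i (cur i) ≢ true
      earlier t with tree⇒added i t
      ... | i′ , i′<i , _  , inj₁ cur≡cur  = cur-injective i′<i i<L (sym cur≡cur)
      ... | i′ , i′<i , a′ , inj₂ cur≡αcur =
        not-¬ (trans (cong head cur≡αcur) (added-head {i′} a′)) (proj₁ (adds⇒ {i} a))

    outside-subtree : ∀ {i} → adds i ≡ true → i < L → ∀ {g} →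
      ReachUsing M (λ x → tree L x ≡ true × x ≢ α (cur i) × x ≢ α (α (cur i))) g → ¬ Desc L i g
    outside-subtree a i<L start d = root-outside a i<L d
    outside-subtree a i<L (turn {g} r) d = outside-subtree a i<L r (desc-∼ d (σ-∼ g))
    outside-subtree {i} a i<L (cross {g} r (intree , _ , g≢tail)) d with bool-cases (head g)
    ... | inj₁ hd with τ , τ<L , aτ , αg≡cur ← treeTail⇒added L (trans (tree-α L g) intree) (α-tail hd) =
      outside-subtree a i<L r
        (child τ (subst (Desc L i) αg≡cur d) aτ τ<L (subst (λ x → α x ∼ g) αg≡cur (0 , α-invol g)))
    ... | inj₂ tail with d
    ...   | base s =
      g≢tail (trans (sym (α-invol g)) (cong α (sym (unique {L} (added⇒treeHead {i} a i<L) αg-head s))))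
      where
      αg-head : TreeHead L (α g)
      αg-head = trans (tree-α L g) intree , α-head tail
    ...   | child τ d′ aτ τ<L s = outside-subtree a i<L r (subst (Desc L i) (α-injective parent) d′)
      where
      parent : α (cur τ) ≡ α g
      parent = unique {L} (added⇒treeHead {τ} aτ τ<L) (trans (tree-α L g) intree , α-head tail) s

    tail⇒deltaTail : ∀ h → head h ≡ false → DeltaTail M (tree L) h
    tail⇒deltaTail h tail with bool-cases (tree L h)
    ... | inj₁ intree with i , i<L , a , refl ← treeTail⇒added L intree tail =
      inj₁ (intree , reachUsing-mono below-i (reach-cur i))
      where
      below-i : ∀ {g} → tree i g ≡ true → tree L g ≡ true × g ≢ cur i × g ≢ α (cur i)
      below-i {g} t = tree-mono (<⇒≤ i<L) t
                    , (λ { refl → not-¬ t (added-edge-new a i<L) })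
                    , (λ { refl → not-¬ (trans (sym (tree-α i (cur i))) t) (added-edge-new a i<L) })
    ... | inj₂ nontree with b , b<L , refl ← reachable⇒visited (reachable h)
                       with a₀ , a₀<b , cur≡ ← nontree-tail-after-head b<L refl nontree tail =
      inj₂ (nontree , a₀ , trans (tour≡cur (<⇒≤ (<-trans a₀<b b<L))) cur≡ , unseen)
      where
      unseen : ∀ j → j ≤ a₀ → tour M (tree L) j ≢ cur b
      unseen j j≤a₀ e = cur-injective (≤-<-trans j≤a₀ a₀<b) b<L
                          (trans (sym (tour≡cur (<⇒≤ (≤-<-trans j≤a₀ (<-trans a₀<b b<L))))) e)

    deltaTail⇒tail : ∀ h → DeltaTail M (tree L) h → head h ≡ false
    deltaTail⇒tail h δtail = ¬-not (contra δtail)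
      where
      contra : DeltaTail M (tree L) h → head h ≢ true
      contra (inj₁ (intree , r)) hd with i , i<L , a , refl ← treeHead⇒added L (intree , hd) =
        outside-subtree a i<L r (base ∼-refl)
      contra (inj₂ (nontree , j , tourʲ≡αh , unseen)) hd
        with b , b<L , cur≡αh ← reachable⇒visited (reachable (α h))
        with a₀ , a₀<b , cur≡ααh ← nontree-tail-after-head b<L cur≡αh (trans (tree-α L h) nontree) (α-tail hd) =
        unseen a₀ (≤-trans (<⇒≤ a₀<b) b≤j)
          (trans (tour≡cur (<⇒≤ (<-trans a₀<b b<L))) (trans cur≡ααh (α-invol h)))
        where
        b≤j : b ≤ j
        b≤j with b ≤? j | j <? L
        ... | yes b≤j | _       = b≤j
        ... | no  b≰j | no  j≮L = ⊥-elim (b≰j (≤-trans (<⇒≤ b<L) (≮⇒≥ j≮L)))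
        ... | no  b≰j | yes j<L =
          ⊥-elim (cur-injective (≰⇒> b≰j) b<L (trans (sym (tour≡cur (<⇒≤ j<L))) (trans tourʲ≡αh (sym cur≡αh))))

corollary1 : {m : ℕ} (M : Map m) (o : Orientation M) →
    TreeOriented M o →
    (h : Fin m) → DeltaTail M (γ M o) h ⇔ IsTail M o h
corollary1 M o (noPositiveCycle , reachable) h
  with L , γ≡tree , 1≤L , returns , first ← GammaRun.first-return M o =
  subst (λ T → DeltaTail M T h ⇔ IsTail M o h) (sym γ≡tree) (mk⇔ (deltaTail⇒tail h) (tail⇒deltaTail h))
  where open GammaRun.Traversal M o noPositiveCycle reachable 1≤L returns first
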